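{- Let $\delta, \delta' \in D_{A} \sqcup S D_A$ and let $I$ be an interpretation. If there is a morphism $f : \delta \to \delta'$ then $[\![ \delta ]\!]_{I} \subseteq [\![ \delta' ]\!]_{I}$.
   Context: Fix a resource monad $S$ with symmetric tensor product and a small category $A$; $D_A$ is the colimit of $D_0=A$, $D_{n+1}=(SD_n)^{o}\times D_n\sqcup A$, whose objects are types $o\in A$ or $\vec{a}\Rightarrow a$ ($\vec{a}\in SD_A$), with morphisms those of $A$ on atoms and $\langle\alpha,\vec{f}\rangle\Rightarrow f : (\vec{a}\Rightarrow a)\to(\vec{a}'\Rightarrow a')$ for $\langle\alpha,\vec{f}\rangle:\vec{a}'\to\vec{a}$ in $SD_A$ and $f:a\to a'$; morphisms $\langle\alpha,f_1,\dots,f_k\rangle:\langle a_1,\dots,a_{k'}\rangle\to\langle a'_1,\dots,a'_k\rangle$ in $SD_A$ consist of $\alpha:[k]\to[k']$ (of the kind allowed by $S$) and $f_i:a_{\alpha(i)}\to a'_i$. A set $\mathcal{X}\subseteq\Lambda$ is saturated if $M[N/x]N_1\dots N_n\in\mathcal{X}$ implies $(\lambda x.M)NN_1\dots N_n\in\mathcal{X}$; $\mathcal{X}_1\Rightarrow\mathcal{X}_2 = \{M \mid \forall N\in\mathcal{X}_1,\ MN\in\mathcal{X}_2\}$. An interpretation is a functor $I : A\to((\wp\Lambda)^{\ast},\subseteq)$ into the poset of saturated sets. The set of realizers is defined by $[\![ o ]\!]_I = I(o)$, $[\![ \langle\rangle ]\!]_I = \Lambda$, $[\![ \langle a_1,\dots,a_k\rangle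 ]\!]_I = \bigcap_i[\![ a_i ]\!]_I$, $[\![ \vec{a}\Rightarrow a ]\!]_I = [\![ \vec{a} ]\!]_I\Rightarrow[\![ a ]\!]_I$. -}

module Defs where

open import Level using (0ℓ)
open import Data.Nat using (ℕ; zero; suc; _<ᵇ_; _≡ᵇ_; pred)
open import Data.Bool using (if_then_else_)
open import Data.Fin using (Fin)
open import Data.List using (List; []; _∷_; length; lookup; foldl)
open import Data.Product using (_×_)
open import Function using (id; _∘_)
open import Relation.Binary.PropositionalEquality using (_≡_)
open import Relation.Unary using (Pred; _⊆_; _∩_; U)

data Λ : Set where
  var : ℕ → Λ
  app : Λ → Λ → Λ
  lam : Λ → Λ

shift : ℕ → Λ → Λ
shift c (var n) = if n <ᵇ c then var n else var (suc n)
shift c (app M N) = app (shift c M) (shift c N)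
shift c (lam M) = lam (shift (suc c) M)

subst : ℕ → Λ → Λ → Λ
subst j N (var n) =
  if n ≡ᵇ j then N else (if j <ᵇ n then var (pred n) else var n)
subst j N (app M₁ M₂) = app (subst j N M₁) (subst j N M₂)
subst j N (lam M) = lam (subst (suc j) (shift 0 N) M)

-- M[N/x] where λx.M is written lam M
_[_] : Λ → Λ → Λ
M [ N ] = subst 0 N M

apps : Λ → List Λ → Λ
apps = foldl app

TermSet : Set₁
TermSet = Pred Λ 0ℓ

Saturated : TermSet → Set
Saturated X = ∀ M N (Ns : List Λ) → X (apps (M [ N ]) Ns) → X (apps (app (lam M) N) Ns)

_⇛_ : TermSet → TermSet → TermSet
(X₁ ⇛ X₂) M = ∀ N → X₁ N → X₂ (app M N)

record Category : Set₁ where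
  field
    Obj : Set
    Hom : Obj → Obj → Set
    idA : ∀ {a} → Hom a a
    _∘A_ : ∀ {a b c} → Hom b c → Hom a b → Hom a c
    idˡ : ∀ {a b} (f : Hom a b) → idA ∘A f ≡ f
    idʳ : ∀ {a b} (f : Hom a b) → f ∘A idA ≡ f
    assoc : ∀ {a b c d} (f : Hom c d) (g : Hom b c) (h : Hom a b) →
            (f ∘A g) ∘A h ≡ f ∘A (g ∘A h)

-- The kind of reindexing maps α : [k] → [k'] allowed by the resource
-- monad S (e.g. bijections for multisets, all maps for lists/sets, …).
record ResourceKind : Set₁ where
  field
    Allowed : ∀ {k k'} → (Fin k → Fin k') → Set
    allowed-id : ∀ {k} → Allowed {k} {k} id
    allowed-∘ : ∀ {k k' k''} {α : Fin k' → Fin k''} {β : Fin k → Fin k'} →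
                Allowed α → Allowed β → Allowed (α ∘ β)

-- A functor A → ((℘Λ)*, ⊆): saturated sets, monotone along morphisms
record Interpretation (A : Category) : Set₁ where
  open Category A
  field
    set : Obj → TermSet
    saturated : ∀ o → Saturated (set o)
    mono : ∀ {o o'} → Hom o o' → set o ⊆ set o'

module Types (A : Category) where
  open Category A

  data Ty : Set where
    atom : Obj → Ty
    _⇒_  : List Ty → Ty → Ty

module Morphisms (A : Category) (S : ResourceKind) where
  open Category A
  open ResourceKind S
  open Types A

  mutual
    data _⟶_ : Ty → Ty → Set where
      atom : ∀ {o o'} → Hom o o' → atom o ⟶ atom o'
      arr  : ∀ {as as' a a'} → as' ⟶ˢ as → a ⟶ a' → (as ⇒ a) ⟶ (as' ⇒ a')

    data _⟶ˢ_ : List Ty → List Ty → Set where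
      mor : ∀ {as bs} (α : Fin (length bs) → Fin (length as)) → Allowed α →
            (∀ i → lookup as (α i) ⟶ lookup bs i) → as ⟶ˢ bs

module Realizers (A : Category) (I : Interpretation A) where
  open Types A
  open Interpretation I

  mutual
    ⟦_⟧ : Ty → TermSet
    ⟦ atom o ⟧ = set o
    ⟦ as ⇒ a ⟧ = ⟦ as ⟧ˢ ⇛ ⟦ a ⟧

    ⟦_⟧ˢ : List Ty → TermSet
    ⟦ [] ⟧ˢ = U
    ⟦ a ∷ as ⟧ˢ = ⟦ a ⟧ ∩ ⟦ as ⟧ˢ

module Submission where

-- The proof is a simultaneous structural induction over the two mutually
-- defined kinds of morphisms.
--   * On atoms, a morphism f : o → o' of A is sent by the interpretation
--     (a functor into the poset of saturated sets) to I(o) ⊆ I(o').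
--   * On arrows, ⟨α,f⃗⟩ ⇒ f : (a⃗ ⇒ a) → (a⃗' ⇒ a') is contravariant in the
--     argument: if M ∈ ⟦a⃗⟧ ⇒ ⟦a⟧ and N ∈ ⟦a⃗'⟧, the induction hypothesis for
--     ⟨α,f⃗⟩ : a⃗' → a⃗ puts N in ⟦a⃗⟧, so M N ∈ ⟦a⟧ ⊆ ⟦a'⟧.
--   * On sequences, ⟦a⃗⟧ is the intersection ⋂ᵢ ⟦aᵢ⟧. A term in it lies in
--     each component ⟦a_{α(i)}⟧ (projection lemma), hence in ⟦a'ᵢ⟧ by
--     induction, hence in ⋂ᵢ ⟦a'ᵢ⟧ (reindexing lemma).
-- The argument works for any reindexing map α.

open import Defs
open import Data.List using (List; []; _∷_; length; lookup)
open import Data.Fin using (Fin; zero; suc)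
open import Data.Product using (_×_; _,_; proj₁; proj₂)
open import Data.Unit using (tt)
open import Relation.Unary using (_⊆_)

module Monotonicity (A : Category) (S : ResourceKind) (I : Interpretation A) where
  open Types A
  open Interpretation I
  open Morphisms A S
  open Realizers A I

  ⟦⟧ˢ-lookup : ∀ (as : List Ty) (j : Fin (length as)) → ⟦ as ⟧ˢ ⊆ ⟦ lookup as j ⟧
  ⟦⟧ˢ-lookup (a ∷ as) zero    (M∈a , _)   = M∈a
  ⟦⟧ˢ-lookup (a ∷ as) (suc j) (_ , M∈as) = ⟦⟧ˢ-lookup as j M∈as

  ⟦⟧ˢ-reindex : ∀ (as bs : List Ty) (α : Fin (length bs) → Fin (length as)) →
                (∀ i → ⟦ lookup as (α i) ⟧ ⊆ ⟦ lookup bs i ⟧) →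
                ⟦ as ⟧ˢ ⊆ ⟦ bs ⟧ˢ
  ⟦⟧ˢ-reindex as []       α incl M∈as = tt
  ⟦⟧ˢ-reindex as (b ∷ bs) α incl M∈as =
      incl zero (⟦⟧ˢ-lookup as (α zero) M∈as)
    , ⟦⟧ˢ-reindex as bs (λ i → α (suc i)) (λ i → incl (suc i)) M∈as

  mutual
    ⟦⟧-mono : ∀ {δ δ'} → δ ⟶ δ' → ⟦ δ ⟧ ⊆ ⟦ δ' ⟧
    ⟦⟧-mono (atom f)  M∈o        = mono f M∈o
    ⟦⟧-mono (arr g h) M∈as⇒a N N∈as' = ⟦⟧-mono h (M∈as⇒a N (⟦⟧ˢ-mono g N∈as'))

    ⟦⟧ˢ-mono : ∀ {δ δ'} → δ ⟶ˢ δ' → ⟦ δ ⟧ˢ ⊆ ⟦ δ' ⟧ˢ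
    ⟦⟧ˢ-mono {as} {bs} (mor α _ fs) = ⟦⟧ˢ-reindex as bs α (λ i → ⟦⟧-mono (fs i))

lemma4 : (A : Category) (S : ResourceKind) (I : Interpretation A) →
    (∀ {δ δ' : Types.Ty A} → Morphisms._⟶_ A S δ δ' →
    Realizers.⟦_⟧ A I δ ⊆ Realizers.⟦_⟧ A I δ')
    × (∀ {δ δ' : List (Types.Ty A)} → Morphisms._⟶ˢ_ A S δ δ' →
    Realizers.⟦_⟧ˢ A I δ ⊆ Realizers.⟦_⟧ˢ A I δ')
lemma4 A S I = ⟦⟧-mono , ⟦⟧ˢ-mono
  where open Monotonicity A S I
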